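{- For every integer $k\ge3$, with $n=2k$, there exist a map $z:[n]\to[k]$ and a vector $(d_k;c_k)\in\mathbb N^{n+\binom{k+1}2}$ such that the simple fiber $\widetilde{\mathcal F}(d_k;c_k)=\{\gamma\in\{0,1\}^{\binom n2}:A_{n,z}\gamma=(d_k;c_k)\}$ consists of exactly two elements $\gamma_1,\gamma_2$, and $\|\gamma_1-\gamma_2\|_1=2k$.
   Context: Coordinates of $\mathbb Z^{\binom n2}$ are indexed by 2-subsets of $[n]$. $A_{n,z}$ is the matrix obtained by stacking the $n\times\binom n2$ vertex-edge incidence matrix of $K_n$ on top of the $\binom{k+1}2\times\binom n2$ matrix whose rows are indexed by pairs $(i,j)$, $1\le i\le j\le k$, and whose column $\{u,v\}$ has a single $1$ in row $(\min(z(u),z(v)),\max(z(u),z(v)))$. For a simple graph $\gamma\in\{0,1\}^{\binom n2}$, $A_{n,z}\gamma$ is its degree sequence followed by the numbers of edges between each pair of color classes. -}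

module Defs where

open import Data.Nat using (ℕ; zero; suc; _+_)
open import Data.Fin using (Fin; zero; suc; _<_; _≤_)
open import Data.Fin.Properties using (_<?_; _≤?_; _≟_)
open import Data.Bool using (Bool; true; false; if_then_else_)
open import Data.Product using (Σ; _×_; _,_; proj₁; proj₂)
open import Relation.Nullary using (yes; no; ¬_)
open import Relation.Binary.PropositionalEquality using (_≡_)

sumFin : (n : ℕ) → (Fin n → ℕ) → ℕ
sumFin zero    f = 0
sumFin (suc n) f = f zero + sumFin n (λ i → f (suc i))

-- 2-subsets {u,v} of [n], represented as ordered pairs u < v
Edge : ℕ → Set
Edge n = Σ (Fin n) λ u → Σ (Fin n) λ v → u < v

-- a simple graph on [n] : a 0/1 vector indexed by 2-subsets
Graph : ℕ → Set
Graph n = Edge n → Bool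

bit : Bool → ℕ
bit true  = 1
bit false = 0

sumEdges : (n : ℕ) → (Edge n → ℕ) → ℕ
sumEdges n f = sumFin n λ u → sumFin n λ v → h u v (u <? v)
  where
  h : (u v : Fin n) → _ → ℕ
  h u v (yes p) = f (u , v , p)
  h u v (no _)  = 0

incident : {n : ℕ} → Fin n → Edge n → ℕ
incident w (u , v , _) with w ≟ u | w ≟ v
... | yes _ | _     = 1
... | no _  | yes _ = 1
... | no _  | no _  = 0

-- degree of w in γ (first block of A_{n,z} γ)
degree : {n : ℕ} → Graph n → Fin n → ℕ
degree {n} γ w = sumEdges n λ e → bit (γ e) * incident w e
  where open import Data.Nat using (_*_)

colorPair : {n k : ℕ} → (Fin n → Fin k) → Edge n → Fin k × Fin k
colorPair z (u , v , _) with z u ≤? z v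
... | yes _ = (z u , z v)
... | no _  = (z v , z u)

inBlock : {n k : ℕ} → (Fin n → Fin k) → Fin k → Fin k → Edge n → ℕ
inBlock z i j e with proj₁ (colorPair z e) ≟ i | proj₂ (colorPair z e) ≟ j
... | yes _ | yes _ = 1
... | _     | _     = 0

-- number of edges of γ between color classes i and j (second block of A_{n,z} γ)
colorCount : {n k : ℕ} → (Fin n → Fin k) → Graph n → Fin k → Fin k → ℕ
colorCount {n} z γ i j = sumEdges n λ e → bit (γ e) * inBlock z i j e
  where open import Data.Nat using (_*_)

-- A_{n,z} γ = (d ; c), where c is indexed by pairs i ≤ j
InFiber : {n k : ℕ} → (Fin n → Fin k) → (Fin n → ℕ) →
          ((i j : Fin k) → i ≤ j → ℕ) → Graph n → Set
InFiber {n} {k} z d c γ =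
  ((w : Fin n) → degree γ w ≡ d w) ×
  ((i j : Fin k) (p : i ≤ j) → colorCount z γ i j ≡ c i j p)

_≈G_ : {n : ℕ} → Graph n → Graph n → Set
γ ≈G δ = ∀ e → γ e ≡ δ e

diffBit : Bool → Bool → ℕ
diffBit true  false = 1
diffBit false true  = 1
diffBit _     _     = 0

l1dist : {n : ℕ} → Graph n → Graph n → ℕ
l1dist {n} γ δ = sumEdges n λ e → diffBit (γ e) (δ e)

-- Put the vertices aᵢ, bᵢ in colour class i ∈ ℤ/k, ask for degree 3 at every aᵢ and 1 at
-- every bᵢ, two edges between consecutive classes and none between any other pair of classes.
-- A graph in this fibre is determined by the 2×2 blocks Bᵢ of edges between classes i and
-- i + 1. Reading off the degrees of aᵢ₊₁ and bᵢ₊₁ shows that Bᵢ = {aᵢaᵢ₊₁, bᵢaᵢ₊₁} or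
-- Bᵢ₊₁ = {aᵢ₊₁aᵢ₊₂, aᵢ₊₁bᵢ₊₂}. These two patterns differ, so once the second one occurs it
-- propagates around the cycle; hence either every block is of the second kind (γ₁) or every
-- block is of the first kind (γ₂). The two graphs differ exactly in the 2k edges aᵢbᵢ₊₁, bᵢaᵢ₊₁.

module Submission where

open import Defs
open import Data.Nat using (ℕ; _≤_; _*_)
open import Data.Fin using (Fin)
open import Data.Product using (Σ; _×_; _,_)
open import Data.Sum using (_⊎_)
open import Relation.Nullary using (¬_)
open import Relation.Binary.PropositionalEquality using (_≡_)

open import Data.Bool using (Bool; true; false; _∧_; _∨_; _xor_; if_then_else_)
import Data.Bool.Properties as Boolₚ
open import Data.Empty using (⊥-elim)
open import Data.Fin
  using (zero; suc; toℕ; fromℕ; inject₁; lower₁; _↑ˡ_; _↑ʳ_; combine; quotient; remainder;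
         punchIn; punchOut)
import Data.Fin as Fin
open import Data.Fin.Induction using (<-weakInduction; <-weakInduction-startingFrom)
open import Data.Fin.Properties using (_<?_; _≤?_; _≟_)
import Data.Fin.Properties as Finₚ
open import Data.Nat using (zero; suc; _+_; z≤n; s≤s)
import Data.Nat.Properties as ℕₚ
open import Data.Product using (proj₁; proj₂)
open import Data.Sum using (inj₁; inj₂; [_,_]′)
import Data.Sum as Sum
open import Function using (_∘_; id; const)
open import Relation.Binary.Definitions using (tri<; tri≈; tri>)
open import Relation.Binary.PropositionalEquality
  using (_≢_; refl; sym; trans; cong; cong₂; subst; ≢-sym; module ≡-Reasoning)
open import Relation.Nullary using (yes; no; Dec; does)
open import Relation.Nullary.Decidable using (_⊎-dec_; dec-true; dec-false)

open import Algebra.Properties.CommutativeMonoid.Sum ℕₚ.+-0-commutativeMonoid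
  using (sum; sum-syntax; sum-cong-≗; sum-replicate-zero; sum-remove; ∑-distrib-+; ∑-comm)

sumFin≡∑ : ∀ n (f : Fin n → ℕ) → sumFin n f ≡ ∑[ i < n ] f i
sumFin≡∑ zero    f = refl
sumFin≡∑ (suc n) f = cong (f zero +_) (sumFin≡∑ n (f ∘ suc))

∑-const : ∀ n c → ∑[ i < n ] c ≡ n * c
∑-const zero    c = refl
∑-const (suc n) c = cong (c +_) (∑-const n c)

∑-zero : ∀ {n} {f : Fin n → ℕ} → (∀ i → f i ≡ 0) → ∑[ i < n ] f i ≡ 0
∑-zero {n} f≗0 = trans (sum-cong-≗ f≗0) (sum-replicate-zero n)

∑≡0⇒ : ∀ {n} (f : Fin n → ℕ) → ∑[ i < n ] f i ≡ 0 → ∀ i → f i ≡ 0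
∑≡0⇒ f ∑≡0 zero    = ℕₚ.m+n≡0⇒m≡0 (f zero) ∑≡0
∑≡0⇒ f ∑≡0 (suc i) = ∑≡0⇒ (f ∘ suc) (ℕₚ.m+n≡0⇒n≡0 (f zero) ∑≡0) i

∑-single : ∀ {n} (f : Fin n → ℕ) i → (∀ j → j ≢ i → f j ≡ 0) → ∑[ j < n ] f j ≡ f i
∑-single {suc n} f i f≡0 = begin
  sum f                     ≡⟨ sum-remove f ⟩
  f i + sum (f ∘ punchIn i) ≡⟨ cong (f i +_) (∑-zero λ j → f≡0 (punchIn i j) (Finₚ.punchInᵢ≢i i j)) ⟩
  f i + 0                   ≡⟨ ℕₚ.+-identityʳ (f i) ⟩
  f i                       ∎
  where open ≡-Reasoning

∑-pair : ∀ {n} (f : Fin n → ℕ) {i j} → i ≢ j → (∀ l → l ≢ i → l ≢ j → f l ≡ 0) →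
         ∑[ l < n ] f l ≡ f i + f j
∑-pair {suc n} f {i} {j} i≢j f≡0 = begin
  sum f                              ≡⟨ sum-remove f ⟩
  f i + sum (f ∘ punchIn i)          ≡⟨ cong (f i +_) (∑-single (f ∘ punchIn i) (punchOut i≢j) off-j) ⟩
  f i + f (punchIn i (punchOut i≢j)) ≡⟨ cong (λ l → f i + f l) (Finₚ.punchIn-punchOut i≢j) ⟩
  f i + f j                          ∎
  where
  open ≡-Reasoning
  off-j : ∀ l → l ≢ punchOut i≢j → f (punchIn i l) ≡ 0
  off-j l l≢ = f≡0 (punchIn i l) (Finₚ.punchInᵢ≢i i l)
    (λ eq → l≢ (Finₚ.punchIn-injective i l _ (trans eq (sym (Finₚ.punchIn-punchOut i≢j)))))

∑-indicator : ∀ {n} (g w : Fin n → ℕ) i → w i ≡ 1 → (∀ j → j ≢ i → w j ≡ 0) →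
              ∑[ j < n ] (g j * w j) ≡ g i
∑-indicator g w i wᵢ≡1 w≡0 = begin
  sum (λ j → g j * w j) ≡⟨ ∑-single _ i (λ j j≢i → trans (cong (g j *_) (w≡0 j j≢i))
                                                         (ℕₚ.*-zeroʳ (g j))) ⟩
  g i * w i             ≡⟨ cong (g i *_) wᵢ≡1 ⟩
  g i * 1               ≡⟨ ℕₚ.*-identityʳ (g i) ⟩
  g i                   ∎
  where open ≡-Reasoning

∑-↑ : ∀ m n (f : Fin (m + n) → ℕ) →
      ∑[ l < m + n ] f l ≡ ∑[ i < m ] f (i ↑ˡ n) + ∑[ j < n ] f (m ↑ʳ j)
∑-↑ zero    n f = refl
∑-↑ (suc m) n f = trans (cong (f zero +_) (∑-↑ m n (f ∘ suc))) (sym (ℕₚ.+-assoc (f zero) _ _))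

∑-combine : ∀ m n (f : Fin (m * n) → ℕ) →
            ∑[ l < m * n ] f l ≡ ∑[ s < m ] ∑[ i < n ] f (combine s i)
∑-combine zero    n f = refl
∑-combine (suc m) n f = trans (∑-↑ n (m * n) f)
  (cong (∑[ i < n ] f (i ↑ˡ m * n) +_) (∑-combine m n (f ∘ (n ↑ʳ_))))

bit≡0⇒ : ∀ {b} → bit b ≡ 0 → b ≡ false
bit≡0⇒ {false} _ = refl

bit≤1 : ∀ b → bit b ≤ 1
bit≤1 true  = s≤s z≤n
bit≤1 false = z≤n

diffBit≡bit-xor : ∀ x y → diffBit x y ≡ bit (x xor y)
diffBit≡bit-xor true  true  = refl
diffBit≡bit-xor true  false = refl
diffBit≡bit-xor false true  = refl
diffBit≡bit-xor false false = refl

∑-bit≤ : ∀ n (f : Fin n → Bool) → ∑[ i < n ] bit (f i) ≤ n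
∑-bit≤ zero    f = z≤n
∑-bit≤ (suc n) f = ℕₚ.+-mono-≤ (bit≤1 (f zero)) (∑-bit≤ n (f ∘ suc))

∑-bit≡0⇒ : ∀ {n} (f : Fin n → Bool) → ∑[ i < n ] bit (f i) ≡ 0 → ∀ i → f i ≡ false
∑-bit≡0⇒ f ∑≡0 i = bit≡0⇒ (∑≡0⇒ (bit ∘ f) ∑≡0 i)

∑-bit≡n⇒ : ∀ n (f : Fin n → Bool) → ∑[ i < n ] bit (f i) ≡ n → ∀ i → f i ≡ true
∑-bit≡n⇒ (suc n) f ∑≡n with f zero in f₀≡
... | true  = λ { zero → f₀≡ ; (suc i) → ∑-bit≡n⇒ n (f ∘ suc) (ℕₚ.suc-injective ∑≡n) i }
... | false = ⊥-elim (ℕₚ.<⇒≢ (s≤s (∑-bit≤ n (f ∘ suc))) ∑≡n)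

δ : ∀ {n} → Fin n → Fin n → ℕ
δ w u = bit (does (w ≟ u))

∑-δ : ∀ {n} (w : Fin n) (g : Fin n → ℕ) → ∑[ u < n ] (g u * δ w u) ≡ g w
∑-δ w g = ∑-indicator g (δ w) w (cong bit (dec-true (w ≟ w) refl))
  λ u u≢w → cong bit (dec-false (w ≟ u) (u≢w ∘ sym))

module _ {k : ℕ} where

  sortPair : Fin k → Fin k → Fin k × Fin k
  sortPair s t with s ≤? t
  ... | yes _ = s , t
  ... | no  _ = t , s

  sortPair-comm : ∀ s t → sortPair s t ≡ sortPair t s
  sortPair-comm s t with s ≤? t | t ≤? s
  ... | yes s≤t | yes t≤s rewrite Finₚ.≤-antisym s≤t t≤s = refl
  ... | yes _   | no _    = refl
  ... | no _    | yes _   = refl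
  ... | no s≰t  | no t≰s  = ⊥-elim (s≰t (ℕₚ.≰⇒≥ t≰s))

  sortPair-≤ : ∀ {s t} → s Fin.≤ t → sortPair s t ≡ (s , t)
  sortPair-≤ {s} {t} s≤t with s ≤? t
  ... | yes _  = refl
  ... | no s≰t = ⊥-elim (s≰t s≤t)

  sortPair-sorted : ∀ s t → proj₁ (sortPair s t) Fin.≤ proj₂ (sortPair s t)
  sortPair-sorted s t with s ≤? t
  ... | yes s≤t = s≤t
  ... | no s≰t  = ℕₚ.≰⇒≥ s≰t

  SamePair : Fin k × Fin k → Fin k × Fin k → Set
  SamePair (s , t) (i , j) = (s ≡ i × t ≡ j) ⊎ (s ≡ j × t ≡ i)

  SamePair-sym : ∀ {x y} → SamePair x y → SamePair y x
  SamePair-sym (inj₁ (refl , refl)) = inj₁ (refl , refl)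
  SamePair-sym (inj₂ (refl , refl)) = inj₂ (refl , refl)

  sortPair-≡ : ∀ {s t i j} → sortPair s t ≡ (i , j) → SamePair (s , t) (i , j)
  sortPair-≡ {s} {t} eq with s ≤? t | eq
  ... | yes _ | refl = inj₁ (refl , refl)
  ... | no _  | refl = inj₂ (refl , refl)

  pairWeight : Fin k → Fin k → Fin k × Fin k → ℕ
  pairWeight i j (s , t) = bit (does (s ≟ i) ∧ does (t ≟ j))

  pairWeight-self : ∀ i j → pairWeight i j (i , j) ≡ 1
  pairWeight-self i j rewrite dec-true (i ≟ i) refl | dec-true (j ≟ j) refl = refl

  pairWeight-cases : ∀ i j x → pairWeight i j x ≡ 0 ⊎ x ≡ (i , j)
  pairWeight-cases i j (s , t) with s ≟ i | t ≟ j
  ... | yes refl | yes refl = inj₂ refl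
  ... | yes _    | no _     = inj₁ refl
  ... | no _     | _        = inj₁ refl

  inBlock≡pairWeight : ∀ {n} (z : Fin n → Fin k) i j e →
                       inBlock z i j e ≡ pairWeight i j (colorPair z e)
  inBlock≡pairWeight z i j e with proj₁ (colorPair z e) ≟ i | proj₂ (colorPair z e) ≟ j
  ... | yes _ | yes _ = refl
  ... | yes _ | no _  = refl
  ... | no _  | _     = refl

  colorPair≡sortPair : ∀ {n} (z : Fin n → Fin k) u v u<v →
                       colorPair z (u , v , u<v) ≡ sortPair (z u) (z v)
  colorPair≡sortPair z u v _ with z u ≤? z v
  ... | yes _ = refl
  ... | no _  = refl

  ∑∑-pairWeight : ∀ {c c′ i j} → c ≢ c′ → sortPair c c′ ≡ (i , j) → (g : Fin k → Fin k → ℕ) →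
                  ∑[ a < k ] ∑[ b < k ] (g a b * pairWeight i j (sortPair a b)) ≡ g c c′ + g c′ c
  ∑∑-pairWeight {c} {c′} {i} {j} c≢c′ sorted g = begin
    ∑[ a < k ] ∑[ b < k ] (g a b * w a b)
      ≡⟨ ∑-pair _ c≢c′ (λ a a≢c a≢c′ → ∑-zero λ b →
           trans (cong (g a b *_) (w-off (other-row a≢c a≢c′))) (ℕₚ.*-zeroʳ (g a b))) ⟩
    ∑[ b < k ] (g c b * w c b) + ∑[ b < k ] (g c′ b * w c′ b)
      ≡⟨ cong₂ _+_ (∑-indicator (g c) (w c) c′ w-on λ b b≢c′ → w-off (row-c b≢c′))
                   (∑-indicator (g c′) (w c′) c w-on′ λ b b≢c → w-off (row-c′ b≢c)) ⟩
    g c c′ + g c′ c ∎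
    where
    open ≡-Reasoning
    w : Fin k → Fin k → ℕ
    w a b = pairWeight i j (sortPair a b)
    w-on : w c c′ ≡ 1
    w-on = trans (cong (pairWeight i j) sorted) (pairWeight-self i j)
    w-on′ : w c′ c ≡ 1
    w-on′ = trans (cong (pairWeight i j) (sortPair-comm c′ c)) w-on
    w-off : ∀ {a b} → ¬ SamePair (a , b) (c , c′) → w a b ≡ 0
    w-off {a} {b} ¬same with pairWeight-cases i j (sortPair a b)
    ... | inj₁ w≡0 = w≡0
    ... | inj₂ eq with sortPair-≡ eq | sortPair-≡ sorted
    ...   | inj₁ (refl , refl) | inj₁ (refl , refl) = ⊥-elim (¬same (inj₁ (refl , refl)))
    ...   | inj₁ (refl , refl) | inj₂ (refl , refl) = ⊥-elim (¬same (inj₂ (refl , refl)))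
    ...   | inj₂ (refl , refl) | inj₁ (refl , refl) = ⊥-elim (¬same (inj₂ (refl , refl)))
    ...   | inj₂ (refl , refl) | inj₂ (refl , refl) = ⊥-elim (¬same (inj₁ (refl , refl)))
    other-row : ∀ {a b} → a ≢ c → a ≢ c′ → ¬ SamePair (a , b) (c , c′)
    other-row a≢c _    (inj₁ (a≡c , _))  = a≢c a≡c
    other-row _   a≢c′ (inj₂ (a≡c′ , _)) = a≢c′ a≡c′
    row-c : ∀ {b} → b ≢ c′ → ¬ SamePair (c , b) (c , c′)
    row-c b≢c′ (inj₁ (_ , b≡c′)) = b≢c′ b≡c′
    row-c _    (inj₂ (c≡c′ , _)) = c≢c′ c≡c′
    row-c′ : ∀ {b} → b ≢ c → ¬ SamePair (c′ , b) (c , c′)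
    row-c′ _   (inj₁ (c′≡c , _)) = c≢c′ (sym c′≡c)
    row-c′ b≢c (inj₂ (_ , b≡c))  = b≢c b≡c

-- Simple graphs as symmetric irreflexive relations

record IsSimple {n : ℕ} (H : Fin n → Fin n → Bool) : Set where
  field
    symmetric   : ∀ u v → H u v ≡ H v u
    irreflexive : ∀ u → H u u ≡ false

toGraph : ∀ {n} → (Fin n → Fin n → Bool) → Graph n
toGraph H (u , v , _) = H u v

module _ {n : ℕ} where

  adj : Graph n → Fin n → Fin n → Bool
  adj γ u v with u <? v | v <? u
  ... | yes u<v | _       = γ (u , v , u<v)
  ... | no _    | yes v<u = γ (v , u , v<u)
  ... | no _    | no _    = false

  adj-isSimple : ∀ γ → IsSimple (adj γ)
  adj-isSimple γ = record { symmetric = adj-sym ; irreflexive = adj-irrefl }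
    where
    adj-sym : ∀ u v → adj γ u v ≡ adj γ v u
    adj-sym u v with u <? v | v <? u
    ... | yes u<v | yes v<u = ⊥-elim (ℕₚ.<-asym u<v v<u)
    ... | yes _   | no _    = refl
    ... | no _    | yes _   = refl
    ... | no _    | no _    = refl

    adj-irrefl : ∀ u → adj γ u u ≡ false
    adj-irrefl u with u <? u
    ... | yes u<u = ⊥-elim (ℕₚ.<-irrefl refl u<u)
    ... | no _    = refl

  ≈G-toGraph-adj : ∀ γ → γ ≈G toGraph (adj γ)
  ≈G-toGraph-adj γ (u , v , u<v) with u <? v
  ... | yes u<v′ = cong (λ p → γ (u , v , p)) (Finₚ.<-irrelevant u<v u<v′)
  ... | no u≮v   = ⊥-elim (u≮v u<v)

  lowerPart : (Edge n → ℕ) → Fin n → Fin n → ℕ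
  lowerPart f u v with u <? v
  ... | yes u<v = f (u , v , u<v)
  ... | no _    = 0

  lowerPart-< : ∀ f {u v} (u<v : u Fin.< v) → lowerPart f u v ≡ f (u , v , u<v)
  lowerPart-< f {u} {v} u<v with u <? v
  ... | yes u<v′ = cong (λ p → f (u , v , p)) (Finₚ.<-irrelevant u<v′ u<v)
  ... | no u≮v   = ⊥-elim (u≮v u<v)

  lowerPart-≮ : ∀ f {u v} → ¬ u Fin.< v → lowerPart f u v ≡ 0
  lowerPart-≮ f {u} {v} u≮v with u <? v
  ... | yes u<v = ⊥-elim (u≮v u<v)
  ... | no _    = refl

  -- The summand of sumEdges is local to Defs, so its type is left to unification.
  mutual
    sumEdges≡∑lowerPart : ∀ f → sumEdges n f ≡ ∑[ u < n ] ∑[ v < n ] lowerPart f u v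
    sumEdges≡∑lowerPart f = trans (sumFin≡∑ n _) (sum-cong-≗ λ u →
      trans (sumFin≡∑ n _) (sum-cong-≗ (summand≡lowerPart f u)))

    summand≡lowerPart : ∀ f u v → _ ≡ lowerPart f u v
    summand≡lowerPart f u v with u <? v
    ... | yes _ = refl
    ... | no _  = refl

  sumEdges-double : ∀ (f : Edge n → ℕ) (W : Fin n → Fin n → ℕ) →
                    (∀ u v → W u v ≡ W v u) → (∀ u → W u u ≡ 0) →
                    (∀ u v u<v → f (u , v , u<v) ≡ W u v) →
                    2 * sumEdges n f ≡ ∑[ u < n ] ∑[ v < n ] W u v
  sumEdges-double f W W-sym W-diag f≡W = sym (begin
    ∑[ u < n ] ∑[ v < n ] W u v
      ≡⟨ sum-cong-≗ (λ u → sum-cong-≗ (split u)) ⟩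
    ∑[ u < n ] ∑[ v < n ] (L u v + L v u)
      ≡⟨ sum-cong-≗ (λ u → ∑-distrib-+ (L u) (λ v → L v u)) ⟩
    ∑[ u < n ] (∑[ v < n ] L u v + ∑[ v < n ] L v u)
      ≡⟨ ∑-distrib-+ (λ u → ∑[ v < n ] L u v) (λ u → ∑[ v < n ] L v u) ⟩
    ∑L + ∑[ u < n ] ∑[ v < n ] L v u
      ≡⟨ cong (∑L +_) (∑-comm (λ u v → L v u)) ⟩
    ∑L + ∑L
      ≡⟨ cong (∑L +_) (ℕₚ.+-identityʳ ∑L) ⟨
    2 * ∑L
      ≡⟨ cong (2 *_) (sumEdges≡∑lowerPart f) ⟨
    2 * sumEdges n f ∎)
    where
    open ≡-Reasoning
    L = lowerPart f
    ∑L = ∑[ u < n ] ∑[ v < n ] L u v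
    split : ∀ u v → W u v ≡ L u v + L v u
    split u v with Finₚ.<-cmp u v
    ... | tri< u<v _ v≮u rewrite lowerPart-< f u<v | lowerPart-≮ f v≮u =
      trans (sym (f≡W u v u<v)) (sym (ℕₚ.+-identityʳ _))
    ... | tri≈ u≮u refl _ rewrite lowerPart-≮ f u≮u = W-diag u
    ... | tri> u≮v _ v<u rewrite lowerPart-≮ f u≮v | lowerPart-< f v<u =
      trans (W-sym u v) (sym (f≡W v u v<u))

  incident≡δ+δ : ∀ (w u v : Fin n) (u<v : u Fin.< v) → incident w (u , v , u<v) ≡ δ w u + δ w v
  incident≡δ+δ w u v u<v with w ≟ u | w ≟ v
  ... | yes refl | yes refl = ⊥-elim (ℕₚ.<-irrefl refl u<v)
  ... | yes _    | no _     = refl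
  ... | no _     | yes _    = refl
  ... | no _     | no _     = refl

  module _ {H : Fin n → Fin n → Bool} (H-simple : IsSimple H) where
    open IsSimple H-simple

    degree-≈ : ∀ {γ} → γ ≈G toGraph H → ∀ w → degree γ w ≡ ∑[ v < n ] bit (H w v)
    degree-≈ {γ} γ≈H w = ℕₚ.*-cancelˡ-≡ _ _ 2 (begin
      2 * degree γ w
        ≡⟨ sumEdges-double _ (λ u v → A u v + B u v) W-sym W-diag edge ⟩
      ∑[ u < n ] ∑[ v < n ] (A u v + B u v)
        ≡⟨ sum-cong-≗ (λ u → ∑-distrib-+ (A u) (B u)) ⟩
      ∑[ u < n ] (∑[ v < n ] A u v + ∑[ v < n ] B u v)
        ≡⟨ ∑-distrib-+ (λ u → ∑[ v < n ] A u v) (λ u → ∑[ v < n ] B u v) ⟩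
      ∑[ u < n ] ∑[ v < n ] A u v + ∑[ u < n ] ∑[ v < n ] B u v
        ≡⟨ cong (_+ ∑[ u < n ] ∑[ v < n ] B u v) (∑-comm A) ⟩
      ∑[ v < n ] ∑[ u < n ] A u v + ∑[ u < n ] ∑[ v < n ] B u v
        ≡⟨ cong₂ _+_ (sum-cong-≗ λ v → ∑-δ w (λ u → bit (H u v)))
                     (sum-cong-≗ λ u → ∑-δ w (λ v → bit (H u v))) ⟩
      ∑[ v < n ] bit (H w v) + ∑[ u < n ] bit (H u w)
        ≡⟨ cong (X +_) (sum-cong-≗ λ u → cong bit (symmetric u w)) ⟩
      X + X
        ≡⟨ cong (X +_) (ℕₚ.+-identityʳ X) ⟨
      2 * X ∎)
      where
      open ≡-Reasoning
      A B : Fin n → Fin n → ℕ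
      A u v = bit (H u v) * δ w u
      B u v = bit (H u v) * δ w v
      X = ∑[ v < n ] bit (H w v)
      W-sym : ∀ u v → A u v + B u v ≡ A v u + B v u
      W-sym u v rewrite symmetric u v = ℕₚ.+-comm (B v u) (A v u)
      W-diag : ∀ u → A u u + B u u ≡ 0
      W-diag u rewrite irreflexive u = refl
      edge : ∀ u v u<v → bit (γ (u , v , u<v)) * incident w (u , v , u<v) ≡ A u v + B u v
      edge u v u<v = trans (cong₂ (λ b x → bit b * x) (γ≈H (u , v , u<v)) (incident≡δ+δ w u v u<v))
                           (ℕₚ.*-distribˡ-+ (bit (H u v)) (δ w u) (δ w v))

    colorCount-≈ : ∀ {k} (z : Fin n → Fin k) {γ} → γ ≈G toGraph H → ∀ i j →
                   2 * colorCount z γ i j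
                     ≡ ∑[ u < n ] ∑[ v < n ] (bit (H u v) * pairWeight i j (sortPair (z u) (z v)))
    colorCount-≈ z {γ} γ≈H i j = sumEdges-double _ _ W-sym W-diag edge
      where
      W-sym : ∀ u v → bit (H u v) * pairWeight i j (sortPair (z u) (z v))
                    ≡ bit (H v u) * pairWeight i j (sortPair (z v) (z u))
      W-sym u v = cong₂ (λ b x → bit b * pairWeight i j x) (symmetric u v) (sortPair-comm (z u) (z v))
      W-diag : ∀ u → bit (H u u) * pairWeight i j (sortPair (z u) (z u)) ≡ 0
      W-diag u rewrite irreflexive u = refl
      edge : ∀ u v u<v → bit (γ (u , v , u<v)) * inBlock z i j (u , v , u<v)
                       ≡ bit (H u v) * pairWeight i j (sortPair (z u) (z v))
      edge u v u<v = cong₂ (λ b x → bit b * x) (γ≈H (u , v , u<v))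
        (trans (inBlock≡pairWeight z i j _) (cong (pairWeight i j) (colorPair≡sortPair z u v u<v)))

  l1dist-toGraph : ∀ {H₁ H₂} → IsSimple H₁ → IsSimple H₂ →
                   2 * l1dist (toGraph H₁) (toGraph H₂)
                     ≡ ∑[ u < n ] ∑[ v < n ] bit (H₁ u v xor H₂ u v)
  l1dist-toGraph H₁-simple H₂-simple = sumEdges-double _ _
    (λ u v → cong bit (cong₂ _xor_ (symmetric H₁-simple u v) (symmetric H₂-simple u v)))
    (λ u → cong bit (cong₂ _xor_ (irreflexive H₁-simple u) (irreflexive H₂-simple u)))
    (λ u v _ → diffBit≡bit-xor _ _)
    where open IsSimple

-- The cyclic order on Fin (suc n)

module _ {n : ℕ} where

  prev : Fin (suc n) → Fin (suc n)
  prev zero    = fromℕ n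
  prev (suc i) = inject₁ i

  next : Fin (suc n) → Fin (suc n)
  next i with n ℕₚ.≟ toℕ i
  ... | yes _  = zero
  ... | no n≢i = suc (lower₁ i n≢i)

  prev-next : ∀ i → prev (next i) ≡ i
  prev-next i with n ℕₚ.≟ toℕ i
  ... | yes n≡i = Finₚ.toℕ-injective (trans (Finₚ.toℕ-fromℕ n) n≡i)
  ... | no n≢i  = Finₚ.inject₁-lower₁ i n≢i

  prev-injective : ∀ {i j} → prev i ≡ prev j → i ≡ j
  prev-injective {zero}  {zero}  _  = refl
  prev-injective {zero}  {suc j} eq = ⊥-elim (Finₚ.fromℕ≢inject₁ eq)
  prev-injective {suc i} {zero}  eq = ⊥-elim (Finₚ.fromℕ≢inject₁ (sym eq))
  prev-injective {suc i} {suc j} eq = cong suc (Finₚ.inject₁-injective eq)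

  next-prev : ∀ i → next (prev i) ≡ i
  next-prev i = prev-injective (prev-next (prev i))

  -- prev (suc j) is inject₁ j, so closure under next is the step of <-weakInduction.
  cycle-induction : ∀ {ℓ} (P : Fin (suc n) → Set ℓ) → (∀ i → P i → P (next i)) →
                    ∀ {i} → P i → ∀ j → P j
  cycle-induction P step {i} Pᵢ = <-weakInduction P (step′ zero P-last) (step′ ∘ suc)
    where
    step′ : ∀ j → P (prev j) → P j
    step′ j = subst P (next-prev j) ∘ step (prev j)
    P-last : P (fromℕ n)
    P-last = <-weakInduction-startingFrom P Pᵢ (step′ ∘ suc) (Finₚ.≤fromℕ i)

  cycle-dichotomy : ∀ {ℓ} (F G : Fin (suc n) → Set ℓ) → (∀ i → F i → ¬ G i) →
                    (∀ i → G i ⊎ F (next i)) → (∀ i → F i) ⊎ (∀ i → G i)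
  cycle-dichotomy F G disjoint step = [ all-G , inj₁ ∘ all-F ]′ (step zero)
    where
    all-F : ∀ {i} → F i → ∀ j → F j
    all-F = cycle-induction F λ i Fᵢ → [ ⊥-elim ∘ disjoint i Fᵢ , id ]′ (step i)
    all-G : G zero → (∀ i → F i) ⊎ (∀ i → G i)
    all-G G₀ = inj₂ λ i → [ id , (λ F-next → ⊥-elim (disjoint zero (all-F F-next zero) G₀)) ]′ (step i)

  Adjacent : Fin (suc n) → Fin (suc n) → Set
  Adjacent i j = j ≡ next i ⊎ i ≡ next j

  adjacent? : ∀ i j → Dec (Adjacent i j)
  adjacent? i j = (j ≟ next i) ⊎-dec (i ≟ next j)

  Adjacent-sym : ∀ {i j} → Adjacent i j → Adjacent j i
  Adjacent-sym = [ inj₂ , inj₁ ]′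

module _ {m : ℕ} where

  prev≢id : (i : Fin (2 + m)) → prev i ≢ i
  prev≢id zero    ()
  prev≢id (suc j) eq = ℕₚ.1+n≢n (sym (trans (sym (Finₚ.toℕ-inject₁ j)) (cong toℕ eq)))

  prev²≢id : (i : Fin (3 + m)) → prev (prev i) ≢ i
  prev²≢id zero          ()
  prev²≢id (suc zero)    ()
  prev²≢id (suc (suc j)) eq = ℕₚ.<⇒≢ (ℕₚ.m<n⇒m<1+n (ℕₚ.n<1+n (toℕ j)))
    (trans (sym (trans (Finₚ.toℕ-inject₁ (inject₁ j)) (Finₚ.toℕ-inject₁ j))) (cong toℕ eq))

  next≢id : (i : Fin (2 + m)) → next i ≢ i
  next≢id i eq = prev≢id i (trans (cong prev (sym eq)) (prev-next i))

  next≢prev : (i : Fin (3 + m)) → next i ≢ prev i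
  next≢prev i eq = prev²≢id i (trans (cong prev (sym eq)) (prev-next i))

  next²≢id : (i : Fin (3 + m)) → next (next i) ≢ i
  next²≢id i eq = next≢prev i (trans (sym (prev-next (next i))) (cong prev eq))

-- Blow-ups of a cycle

module _ {r : ℕ} where

  rowSum colSum : (Fin r → Fin r → Bool) → Fin r → ℕ
  rowSum B s = ∑[ t < r ] bit (B s t)
  colSum B t = ∑[ s < r ] bit (B s t)

  module _ {B B′ : Fin r → Fin r → Bool} (B≗B′ : ∀ s t → B s t ≡ B′ s t) where

    rowSum-cong : ∀ s → rowSum B s ≡ rowSum B′ s
    rowSum-cong s = sum-cong-≗ λ t → cong bit (B≗B′ s t)

    colSum-cong : ∀ t → colSum B t ≡ colSum B′ t
    colSum-cong t = sum-cong-≗ λ s → cong bit (B≗B′ s t)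

module Blowup (r m : ℕ) where

  Colour : Set
  Colour = Fin (3 + m)

  Vertex : Set
  Vertex = Fin (r * (3 + m))

  vertex : Fin r → Colour → Vertex
  vertex = combine

  layer : Vertex → Fin r
  layer = quotient (3 + m)

  colour : Vertex → Colour
  colour = remainder {r} (3 + m)

  layer-vertex : ∀ s i → layer (vertex s i) ≡ s
  layer-vertex s i = cong proj₁ (Finₚ.remQuot-combine s i)

  colour-vertex : ∀ s i → colour (vertex s i) ≡ i
  colour-vertex s i = cong proj₂ (Finₚ.remQuot-combine s i)

  ∀-vertex : ∀ {ℓ} {P : Vertex → Set ℓ} → (∀ s i → P (vertex s i)) → ∀ v → P v
  ∀-vertex {P = P} P-vertex v =
    subst P (Finₚ.combine-remQuot {r} (3 + m) v) (P-vertex (layer v) (colour v))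

  ∑-vertex : (f : Vertex → ℕ) →
             ∑[ v < r * (3 + m) ] f v ≡ ∑[ s < r ] ∑[ i < 3 + m ] f (vertex s i)
  ∑-vertex = ∑-combine r (3 + m)

  OnCycle : (Vertex → Vertex → Bool) → Set
  OnCycle H = ∀ s i t j → ¬ Adjacent i j → H (vertex s i) (vertex t j) ≡ false

  block : (Vertex → Vertex → Bool) → Colour → Fin r → Fin r → Bool
  block H c s t = H (vertex s c) (vertex t (next c))

  ¬Adjacent-intro : ∀ {i j : Colour} → j ≢ next i → j ≢ prev i → ¬ Adjacent i j
  ¬Adjacent-intro j≢next _      (inj₁ j≡next) = j≢next j≡next
  ¬Adjacent-intro _      j≢prev (inj₂ i≡next) =
    j≢prev (trans (sym (prev-next _)) (cong prev (sym i≡next)))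

  Adjacent-SamePair : ∀ {a b i j : Colour} → SamePair (a , b) (i , j) → Adjacent a b → Adjacent i j
  Adjacent-SamePair (inj₁ (refl , refl)) a~b = a~b
  Adjacent-SamePair (inj₂ (refl , refl)) a~b = Adjacent-sym a~b

  adjacent-sortPair : ∀ {i j} → i Fin.≤ j → Adjacent i j → Σ Colour λ c → sortPair c (next c) ≡ (i , j)
  adjacent-sortPair i≤j (inj₁ refl) = _ , sortPair-≤ i≤j
  adjacent-sortPair i≤j (inj₂ refl) = _ , trans (sortPair-comm _ _) (sortPair-≤ i≤j)

  ∑-neighbours : ∀ {H} → (∀ u v → H u v ≡ H v u) → OnCycle H → ∀ s c →
                 ∑[ v < r * (3 + m) ] bit (H (vertex s c) v)
                   ≡ rowSum (block H c) s + colSum (block H (prev c)) s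
  ∑-neighbours {H} H-sym H-on s c = begin
    ∑[ v < r * (3 + m) ] bit (H (vertex s c) v)
      ≡⟨ ∑-vertex _ ⟩
    ∑[ t < r ] ∑[ j < 3 + m ] bit (H (vertex s c) (vertex t j))
      ≡⟨ sum-cong-≗ (λ t → ∑-pair _ (next≢prev c) λ j j≢next j≢prev →
           cong bit (H-on s c t j (¬Adjacent-intro j≢next j≢prev))) ⟩
    ∑[ t < r ] (bit (block H c s t) + bit (H (vertex s c) (vertex t (prev c))))
      ≡⟨ ∑-distrib-+ (λ t → bit (block H c s t)) (λ t → bit (H (vertex s c) (vertex t (prev c)))) ⟩
    rowSum (block H c) s + ∑[ t < r ] bit (H (vertex s c) (vertex t (prev c)))
      ≡⟨ cong (rowSum (block H c) s +_) (sum-cong-≗ λ t → cong bit (trans (H-sym _ _)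
           (cong (H (vertex t (prev c)) ∘ vertex s) (sym (next-prev c))))) ⟩
    rowSum (block H c) s + colSum (block H (prev c)) s ∎
    where open ≡-Reasoning

  pairCount : (Vertex → Vertex → Bool) → Colour → Colour → ℕ
  pairCount H i j = ∑[ u < r * (3 + m) ] ∑[ v < r * (3 + m) ]
                      (bit (H u v) * pairWeight i j (sortPair (colour u) (colour v)))

  pairWeight-vertex : ∀ i j s a t b →
                      pairWeight i j (sortPair (colour (vertex s a)) (colour (vertex t b)))
                        ≡ pairWeight i j (sortPair a b)
  pairWeight-vertex i j s a t b =
    cong₂ (λ x y → pairWeight i j (sortPair x y)) (colour-vertex s a) (colour-vertex t b)

  pairCount-block : ∀ {H} → (∀ u v → H u v ≡ H v u) → ∀ {c i j} → sortPair c (next c) ≡ (i , j) →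
                    pairCount H i j ≡ 2 * ∑[ s < r ] rowSum (block H c) s
  pairCount-block {H} H-sym {c} {i} {j} sorted = begin
    pairCount H i j
      ≡⟨ ∑-vertex _ ⟩
    ∑[ s < r ] ∑[ a < 3 + m ] ∑[ v < r * (3 + m) ] F (vertex s a) v
      ≡⟨ sum-cong-≗ (λ s → sum-cong-≗ λ a → ∑-vertex (F (vertex s a))) ⟩
    ∑[ s < r ] ∑[ a < 3 + m ] ∑[ t < r ] ∑[ b < 3 + m ] F (vertex s a) (vertex t b)
      ≡⟨ sum-cong-≗ (λ s → ∑-comm λ a t → ∑[ b < 3 + m ] F (vertex s a) (vertex t b)) ⟩
    ∑[ s < r ] ∑[ t < r ] ∑[ a < 3 + m ] ∑[ b < 3 + m ] F (vertex s a) (vertex t b)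
      ≡⟨ sum-cong-≗ (λ s → sum-cong-≗ λ t → trans
           (sum-cong-≗ λ a → sum-cong-≗ λ b → cong (bit (H (vertex s a) (vertex t b)) *_)
                                                    (pairWeight-vertex i j s a t b))
           (∑∑-pairWeight (≢-sym (next≢id c)) sorted λ a b → bit (H (vertex s a) (vertex t b)))) ⟩
    ∑[ s < r ] ∑[ t < r ] (A s t + B s t)
      ≡⟨ sum-cong-≗ (λ s → ∑-distrib-+ (A s) (B s)) ⟩
    ∑[ s < r ] (∑[ t < r ] A s t + ∑[ t < r ] B s t)
      ≡⟨ ∑-distrib-+ (λ s → ∑[ t < r ] A s t) (λ s → ∑[ t < r ] B s t) ⟩
    X + ∑[ s < r ] ∑[ t < r ] B s t
      ≡⟨ cong (X +_) (trans (sum-cong-≗ λ s → sum-cong-≗ λ t →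
           cong bit (H-sym (vertex s (next c)) (vertex t c))) (∑-comm λ s t → A t s)) ⟩
    X + X
      ≡⟨ cong (X +_) (ℕₚ.+-identityʳ X) ⟨
    2 * X ∎
    where
    open ≡-Reasoning
    F : Vertex → Vertex → ℕ
    F u v = bit (H u v) * pairWeight i j (sortPair (colour u) (colour v))
    A B : Fin r → Fin r → ℕ
    A s t = bit (block H c s t)
    B s t = bit (H (vertex s (next c)) (vertex t c))
    X = ∑[ s < r ] ∑[ t < r ] A s t

  pairCount-offCycle : ∀ {H} → OnCycle H → ∀ {i j} → ¬ Adjacent i j → pairCount H i j ≡ 0
  pairCount-offCycle {H} H-on {i} {j} ¬i~j = ∑-zero λ u → ∑-zero λ v → term u v
    where
    term : ∀ u v → bit (H u v) * pairWeight i j (sortPair (colour u) (colour v)) ≡ 0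
    term = ∀-vertex λ s a → ∀-vertex λ t b →
      trans (cong (bit (H (vertex s a) (vertex t b)) *_) (pairWeight-vertex i j s a t b)) (at s a t b)
      where
      at : ∀ s a t b → bit (H (vertex s a) (vertex t b)) * pairWeight i j (sortPair a b) ≡ 0
      at s a t b with pairWeight-cases i j (sortPair a b)
      ... | inj₁ w≡0 = trans (cong (bit (H (vertex s a) (vertex t b)) *_) w≡0)
                             (ℕₚ.*-zeroʳ (bit (H (vertex s a) (vertex t b))))
      ... | inj₂ eq rewrite H-on s a t b (¬i~j ∘ Adjacent-SamePair (sortPair-≡ eq)) = refl

  onCycle-from-pairCounts : ∀ {H} → (∀ i j → i Fin.≤ j → ¬ Adjacent i j → pairCount H i j ≡ 0) →
                            OnCycle H
  onCycle-from-pairCounts {H} count≡0 s a t b ¬a~b = bit≡0⇒ (begin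
    bit (H u v)
      ≡⟨ ℕₚ.*-identityʳ _ ⟨
    bit (H u v) * 1
      ≡⟨ cong (bit (H u v) *_)
              (trans (sym (pairWeight-self i j)) (sym (pairWeight-vertex i j s a t b))) ⟩
    bit (H u v) * pairWeight i j (sortPair (colour u) (colour v))
      ≡⟨ ∑≡0⇒ _ (∑≡0⇒ _ (count≡0 i j (sortPair-sorted a b) ¬i~j) u) v ⟩
    0 ∎)
    where
    open ≡-Reasoning
    u = vertex s a
    v = vertex t b
    i = proj₁ (sortPair a b)
    j = proj₂ (sortPair a b)
    ¬i~j : ¬ Adjacent i j
    ¬i~j = ¬a~b ∘ Adjacent-SamePair (SamePair-sym (sortPair-≡ refl))

  forwardBlocks : (Colour → Fin r → Fin r → Bool) → Vertex → Vertex → Bool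
  forwardBlocks β u v = does (colour v ≟ next (colour u)) ∧ β (colour u) (layer u) (layer v)

  fromBlocks : (Colour → Fin r → Fin r → Bool) → Vertex → Vertex → Bool
  fromBlocks β u v = forwardBlocks β u v ∨ forwardBlocks β v u

  fromBlocks-vertex : ∀ β s i t j → fromBlocks β (vertex s i) (vertex t j)
                                    ≡ (does (j ≟ next i) ∧ β i s t) ∨ (does (i ≟ next j) ∧ β j t s)
  fromBlocks-vertex β s i t j
    rewrite colour-vertex s i | colour-vertex t j | layer-vertex s i | layer-vertex t j = refl

  fromBlocks-onCycle : ∀ β → OnCycle (fromBlocks β)
  fromBlocks-onCycle β s i t j ¬i~j rewrite fromBlocks-vertex β s i t j
    | dec-false (j ≟ next i) (¬i~j ∘ inj₁) | dec-false (i ≟ next j) (¬i~j ∘ inj₂) = refl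

  fromBlocks-isSimple : ∀ β → IsSimple (fromBlocks β)
  fromBlocks-isSimple β = record
    { symmetric   = λ u v → Boolₚ.∨-comm (forwardBlocks β u v) (forwardBlocks β v u)
    ; irreflexive = ∀-vertex λ s i →
        fromBlocks-onCycle β s i s i λ i~i → next≢id i (sym ([ id , id ]′ i~i))
    }

  block-fromBlocks : ∀ β c s t → block (fromBlocks β) c s t ≡ β c s t
  block-fromBlocks β c s t rewrite fromBlocks-vertex β s c t (next c)
    | dec-true (next c ≟ next c) refl | dec-false (c ≟ next (next c)) (≢-sym (next²≢id c)) =
    Boolₚ.∨-identityʳ _

  blocks-determine : ∀ {H H′} → (∀ u v → H u v ≡ H v u) → (∀ u v → H′ u v ≡ H′ v u) →
                     OnCycle H → OnCycle H′ → (∀ c s t → block H c s t ≡ block H′ c s t) →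
                     ∀ u v → H u v ≡ H′ u v
  blocks-determine {H} {H′} H-sym H′-sym H-on H′-on same =
    ∀-vertex λ s i → ∀-vertex λ t j → at s i t j
    where
    at : ∀ s i t j → H (vertex s i) (vertex t j) ≡ H′ (vertex s i) (vertex t j)
    at s i t j with adjacent? i j
    ... | yes (inj₁ refl) = same i s t
    ... | yes (inj₂ refl) = trans (H-sym _ _) (trans (same j t s) (H′-sym _ _))
    ... | no ¬i~j         = trans (H-on s i t j ¬i~j) (sym (H′-on s i t j ¬i~j))

  record BlockProfile (deg : Fin r → ℕ) (e : ℕ) (B : Colour → Fin r → Fin r → Bool) : Set where
    field
      degrees : ∀ c s → rowSum (B c) s + colSum (B (prev c)) s ≡ deg s
      total   : ∀ c → ∑[ s < r ] rowSum (B c) s ≡ e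

  fromBlocks-profile : ∀ {deg e β} → BlockProfile deg e β → BlockProfile deg e (block (fromBlocks β))
  fromBlocks-profile {β = β} profile = record
    { degrees = λ c s → trans (cong₂ _+_ (rowSum-cong (block-fromBlocks β c) s)
                                         (colSum-cong (block-fromBlocks β (prev c)) s))
                              (BlockProfile.degrees profile c s)
    ; total   = λ c → trans (sum-cong-≗ (rowSum-cong (block-fromBlocks β c)))
                            (BlockProfile.total profile c)
    }

  cycleCounts : ℕ → (i j : Colour) → i Fin.≤ j → ℕ
  cycleCounts e i j _ = if does (adjacent? i j) then e else 0

  cycleCounts-adjacent : ∀ e {i j} i≤j → Adjacent i j → cycleCounts e i j i≤j ≡ e
  cycleCounts-adjacent e {i} {j} _ i~j rewrite dec-true (adjacent? i j) i~j = refl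

  cycleCounts-¬adjacent : ∀ e {i j} i≤j → ¬ Adjacent i j → cycleCounts e i j i≤j ≡ 0
  cycleCounts-¬adjacent e {i} {j} _ ¬i~j rewrite dec-false (adjacent? i j) ¬i~j = refl

  module _ {deg : Fin r → ℕ} {e : ℕ} where

    toGraph-inFiber : ∀ {H} → IsSimple H → OnCycle H → BlockProfile deg e (block H) →
                      InFiber colour (deg ∘ layer) (cycleCounts e) (toGraph H)
    toGraph-inFiber {H} H-simple H-on profile = degrees , counts
      where
      open IsSimple H-simple
      degrees : ∀ w → degree (toGraph H) w ≡ deg (layer w)
      degrees = ∀-vertex λ s c → begin
        degree (toGraph H) (vertex s c)
          ≡⟨ degree-≈ H-simple (λ _ → refl) (vertex s c) ⟩
        ∑[ v < r * (3 + m) ] bit (H (vertex s c) v)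
          ≡⟨ ∑-neighbours symmetric H-on s c ⟩
        rowSum (block H c) s + colSum (block H (prev c)) s
          ≡⟨ BlockProfile.degrees profile c s ⟩
        deg s
          ≡⟨ cong deg (layer-vertex s c) ⟨
        deg (layer (vertex s c)) ∎
        where open ≡-Reasoning
      twice-count : ∀ i j → 2 * colorCount colour (toGraph H) i j ≡ pairCount H i j
      twice-count = colorCount-≈ H-simple colour (λ _ → refl)
      counts : ∀ i j i≤j → colorCount colour (toGraph H) i j ≡ cycleCounts e i j i≤j
      counts i j i≤j with adjacent? i j
      ... | yes i~j = let c , sorted = adjacent-sortPair i≤j i~j in
        trans (ℕₚ.*-cancelˡ-≡ _ _ 2 (trans (twice-count i j) (trans (pairCount-block symmetric sorted)
                                      (cong (2 *_) (BlockProfile.total profile c)))))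
              (sym (cycleCounts-adjacent e i≤j i~j))
      ... | no ¬i~j =
        trans (ℕₚ.*-cancelˡ-≡ _ _ 2 (trans (twice-count i j) (pairCount-offCycle {H} H-on ¬i~j)))
              (sym (cycleCounts-¬adjacent e i≤j ¬i~j))

    inFiber⇒blockProfile : ∀ {γ} → InFiber colour (deg ∘ layer) (cycleCounts e) γ →
                           OnCycle (adj γ) × BlockProfile deg e (block (adj γ))
    inFiber⇒blockProfile {γ} (degree≡ , count≡) = H-on , record { degrees = degrees ; total = total }
      where
      H = adj γ
      open IsSimple (adj-isSimple γ)
      twice-count : ∀ i j → 2 * colorCount colour γ i j ≡ pairCount H i j
      twice-count = colorCount-≈ (adj-isSimple γ) colour (≈G-toGraph-adj γ)
      H-on : OnCycle H
      H-on = onCycle-from-pairCounts {H} λ i j i≤j ¬i~j → trans (sym (twice-count i j))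
        (cong (2 *_) (trans (count≡ i j i≤j) (cycleCounts-¬adjacent e i≤j ¬i~j)))
      degrees : ∀ c s → rowSum (block H c) s + colSum (block H (prev c)) s ≡ deg s
      degrees c s = begin
        rowSum (block H c) s + colSum (block H (prev c)) s
          ≡⟨ ∑-neighbours symmetric H-on s c ⟨
        ∑[ v < r * (3 + m) ] bit (H (vertex s c) v)
          ≡⟨ degree-≈ (adj-isSimple γ) (≈G-toGraph-adj γ) (vertex s c) ⟨
        degree γ (vertex s c)
          ≡⟨ degree≡ (vertex s c) ⟩
        deg (layer (vertex s c))
          ≡⟨ cong deg (layer-vertex s c) ⟩
        deg s ∎
        where open ≡-Reasoning
      total : ∀ c → ∑[ s < r ] rowSum (block H c) s ≡ e
      total c = ℕₚ.*-cancelˡ-≡ _ _ 2 (begin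
        2 * ∑[ s < r ] rowSum (block H c) s ≡⟨ pairCount-block symmetric refl ⟨
        pairCount H i j                     ≡⟨ twice-count i j ⟨
        2 * colorCount colour γ i j         ≡⟨ cong (2 *_) (count≡ i j i≤j) ⟩
        2 * cycleCounts e i j i≤j           ≡⟨ cong (2 *_) (cycleCounts-adjacent e i≤j i~j) ⟩
        2 * e                               ∎)
        where
        open ≡-Reasoning
        i = proj₁ (sortPair c (next c))
        j = proj₂ (sortPair c (next c))
        i≤j = sortPair-sorted c (next c)
        i~j : Adjacent i j
        i~j = Adjacent-SamePair (sortPair-≡ {s = c} {t = next c} refl) (inj₁ refl)

-- Two layers: the vertices aᵢ form layer zero, the vertices bᵢ layer one

sums-dichotomy : ∀ {ca cb ra rb : ℕ} → ra ≤ 2 → ca + ra ≡ 3 → ca + cb ≡ 2 → cb + rb ≡ 1 →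
                 (ca ≡ 2 × cb ≡ 0) ⊎ (ra ≡ 2 × rb ≡ 0)
sums-dichotomy {0}                 (s≤s (s≤s ())) refl _    _
sums-dichotomy {1}                 _              refl refl refl = inj₂ (refl , refl)
sums-dichotomy {2}                 _              _    refl _    = inj₁ (refl , refl)
sums-dichotomy {suc (suc (suc _))} _              _    ()   _

module TwoLayers (m : ℕ) where
  open Blowup 2 m

  isFirst : Fin 2 → Bool
  isFirst zero    = true
  isFirst (suc _) = false

  aRow aCol : Fin 2 → Fin 2 → Bool
  aRow s _ = isFirst s
  aCol _ t = isFirst t

  layerDegree : Fin 2 → ℕ
  layerDegree zero    = 3
  layerDegree (suc _) = 1

  aCol-or-next-aRow : ∀ (B B′ : Fin 2 → Fin 2 → Bool) →
                      (∀ s → rowSum B′ s + colSum B s ≡ layerDegree s) → ∑[ s < 2 ] rowSum B s ≡ 2 →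
                      (∀ s t → B s t ≡ aCol s t) ⊎ (∀ s t → B′ s t ≡ aRow s t)
  aCol-or-next-aRow B B′ degrees total =
    Sum.map (λ (ca≡2 , cb≡0) → columns ca≡2 cb≡0) (λ (ra≡2 , rb≡0) → rows ra≡2 rb≡0)
      (sums-dichotomy (∑-bit≤ 2 (B′ zero))
                      (trans (ℕₚ.+-comm (colSum B zero) _) (degrees zero))
                      (trans (cong (colSum B zero +_) (sym (ℕₚ.+-identityʳ _)))
                             (trans (sym (∑-comm λ s t → bit (B s t))) total))
                      (trans (ℕₚ.+-comm (colSum B (suc zero)) _) (degrees (suc zero))))
    where
    columns : colSum B zero ≡ 2 → colSum B (suc zero) ≡ 0 → ∀ s t → B s t ≡ aCol s t
    columns ca≡2 _    s zero       = ∑-bit≡n⇒ 2 (λ s → B s zero) ca≡2 s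
    columns _    cb≡0 s (suc zero) = ∑-bit≡0⇒ (λ s → B s (suc zero)) cb≡0 s
    rows : rowSum B′ zero ≡ 2 → rowSum B′ (suc zero) ≡ 0 → ∀ s t → B′ s t ≡ aRow s t
    rows ra≡2 _    zero       t = ∑-bit≡n⇒ 2 (B′ zero) ra≡2 t
    rows _    rb≡0 (suc zero) t = ∑-bit≡0⇒ (B′ (suc zero)) rb≡0 t

  uniform : (Fin 2 → Fin 2 → Bool) → Vertex → Vertex → Bool
  uniform B = fromBlocks (const B)

  G₁ G₂ : Vertex → Vertex → Bool
  G₁ = uniform aRow
  G₂ = uniform aCol

  Fiber : Graph (2 * (3 + m)) → Set
  Fiber = InFiber colour (layerDegree ∘ layer) (cycleCounts 2)

  uniform-inFiber : ∀ B → (∀ s → rowSum B s + colSum B s ≡ layerDegree s) →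
                    ∑[ s < 2 ] rowSum B s ≡ 2 → Fiber (toGraph (uniform B))
  uniform-inFiber B degrees total =
    toGraph-inFiber {deg = layerDegree} (fromBlocks-isSimple (const B)) (fromBlocks-onCycle (const B))
      (fromBlocks-profile {β = const B} record { degrees = const degrees ; total = const total })

  G₁-inFiber : Fiber (toGraph G₁)
  G₁-inFiber = uniform-inFiber aRow (λ { zero → refl ; (suc zero) → refl }) refl

  G₂-inFiber : Fiber (toGraph G₂)
  G₂-inFiber = uniform-inFiber aCol (λ { zero → refl ; (suc zero) → refl }) refl

  G₁≉G₂ : ¬ (toGraph G₁ ≈G toGraph G₂)
  G₁≉G₂ G₁≈G₂ with trans (sym (block-fromBlocks (const aRow) zero zero (suc zero)))
                         (trans (G₁≈G₂ (vertex zero zero , vertex (suc zero) (next zero) , s≤s z≤n))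
                                (block-fromBlocks (const aCol) zero zero (suc zero)))
  ... | ()

  fiber-dichotomy : ∀ {γ} → Fiber γ → (γ ≈G toGraph G₁) ⊎ (γ ≈G toGraph G₂)
  fiber-dichotomy {γ} γ-in =
    Sum.map (≈uniform aRow) (≈uniform aCol) (cycle-dichotomy F G disjoint step)
    where
    H = adj γ
    blockFacts = inFiber⇒blockProfile {deg = layerDegree} {γ = γ} γ-in
    H-on = proj₁ blockFacts
    open BlockProfile (proj₂ blockFacts)
    F G : Colour → Set
    F c = ∀ s t → block H c s t ≡ aRow s t
    G c = ∀ s t → block H c s t ≡ aCol s t
    disjoint : ∀ c → F c → ¬ G c
    disjoint c Fc Gc with trans (sym (Fc zero (suc zero))) (Gc zero (suc zero))
    ... | ()
    step : ∀ c → G c ⊎ F (next c)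
    step c = aCol-or-next-aRow (block H c) (block H (next c))
      (λ s → trans (cong (λ c′ → rowSum (block H (next c)) s + colSum (block H c′) s)
                         (sym (prev-next c)))
                   (degrees (next c) s))
      (total c)
    ≈uniform : ∀ B → (∀ c s t → block H c s t ≡ B s t) → γ ≈G toGraph (uniform B)
    ≈uniform B H≗B (u , v , u<v) = trans (≈G-toGraph-adj γ (u , v , u<v))
      (blocks-determine (IsSimple.symmetric (adj-isSimple γ))
                        (IsSimple.symmetric (fromBlocks-isSimple (const B)))
                        H-on (fromBlocks-onCycle (const B))
                        (λ c s t → trans (H≗B c s t) (sym (block-fromBlocks (const B) c s t))) u v)

  -- The symmetric difference D of G₁ and G₂ is 2-regular.
  distance : l1dist (toGraph G₁) (toGraph G₂) ≡ 2 * (3 + m)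
  distance = ℕₚ.*-cancelˡ-≡ _ _ 2 (begin
    2 * l1dist (toGraph G₁) (toGraph G₂)
      ≡⟨ l1dist-toGraph (fromBlocks-isSimple (const aRow)) (fromBlocks-isSimple (const aCol)) ⟩
    ∑[ u < 2 * (3 + m) ] ∑[ v < 2 * (3 + m) ] bit (D u v)
      ≡⟨ sum-cong-≗ (∀-vertex {P = λ u → ∑[ v < 2 * (3 + m) ] bit (D u v) ≡ 2} degree-D) ⟩
    ∑[ u < 2 * (3 + m) ] 2
      ≡⟨ ∑-const (2 * (3 + m)) 2 ⟩
    2 * (3 + m) * 2
      ≡⟨ ℕₚ.*-comm (2 * (3 + m)) 2 ⟩
    2 * (2 * (3 + m)) ∎)
    where
    open ≡-Reasoning
    D : Vertex → Vertex → Bool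
    D u v = G₁ u v xor G₂ u v
    D-sym : ∀ u v → D u v ≡ D v u
    D-sym u v = cong₂ _xor_ (IsSimple.symmetric (fromBlocks-isSimple (const aRow)) u v)
                            (IsSimple.symmetric (fromBlocks-isSimple (const aCol)) u v)
    D-on : OnCycle D
    D-on s i t j ¬i~j = cong₂ _xor_ (fromBlocks-onCycle (const aRow) s i t j ¬i~j)
                                    (fromBlocks-onCycle (const aCol) s i t j ¬i~j)
    offDiagonal : Fin 2 → Fin 2 → Bool
    offDiagonal s t = aRow s t xor aCol s t
    block-D : ∀ c s t → block D c s t ≡ offDiagonal s t
    block-D c s t = cong₂ _xor_ (block-fromBlocks (const aRow) c s t)
                                (block-fromBlocks (const aCol) c s t)
    offDiagonal-degree : ∀ s → rowSum offDiagonal s + colSum offDiagonal s ≡ 2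
    offDiagonal-degree zero       = refl
    offDiagonal-degree (suc zero) = refl
    degree-D : ∀ s c → ∑[ v < 2 * (3 + m) ] bit (D (vertex s c) v) ≡ 2
    degree-D s c = trans (∑-neighbours D-sym D-on s c)
      (trans (cong₂ _+_ (rowSum-cong (block-D c) s) (colSum-cong (block-D (prev c)) s))
             (offDiagonal-degree s))

proposition3p1 : (k : ℕ) → 3 ≤ k →
    Σ (Fin (2 * k) → Fin k) λ z →
    Σ (Fin (2 * k) → ℕ) λ d →
    Σ ((i j : Fin k) → Data.Fin._≤_ i j → ℕ) λ c →
    Σ (Graph (2 * k)) λ γ₁ →
    Σ (Graph (2 * k)) λ γ₂ →
      InFiber z d c γ₁ × InFiber z d c γ₂ × ¬ (γ₁ ≈G γ₂) ×
      ((γ : Graph (2 * k)) → InFiber z d c γ → (γ ≈G γ₁) ⊎ (γ ≈G γ₂)) ×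
      l1dist γ₁ γ₂ ≡ 2 * k
proposition3p1 _ (s≤s (s≤s (s≤s (z≤n {m})))) =
  colour , layerDegree ∘ layer , cycleCounts 2 , toGraph G₁ , toGraph G₂ ,
  G₁-inFiber , G₂-inFiber , G₁≉G₂ , (λ _ → fiber-dichotomy) , distance
  where
  open Blowup 2 m
  open TwoLayers m
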